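{- Let $n\geq 4$ be an even integer, let $\mathbb{D}_{2n}=\langle a,b \mid a^n=b^2=1,\ ba=a^{n-1}b\rangle$, let $\Psi=\{ab, a^{2}b, \dots , a^{n-1}b, b\}\cup\{a^{n/2}\}$, and let $\Lambda=\mathrm{Cay}(\mathbb{D}_{2n}, \Psi)$. Then the strong metric dimension of $\Lambda$ is $2n-2$.
   Context: For a finite group $G$ and an inverse-closed subset $Q\subseteq G\setminus\{1\}$, the Cayley graph $\mathrm{Cay}(G,Q)$ has vertex set $G$ and edge set $\{\{x,y\} : x^{ -1}y\in Q\}$. In a connected graph $\Gamma$, a vertex $w$ strongly resolves vertices $u,v$ if $u$ lies on some shortest $v$–$w$ path or $v$ lies on some shortest $u$–$w$ path. A set $S$ of vertices is a strong resolving set if every two distinct vertices of $\Gamma$ are strongly resolved by some vertex of $S$. The strong metric dimension $\mathrm{sdim}(\Gamma)$ is the minimum cardinality of a strong resolving set. -}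

module Defs where

open import Data.Nat using (ℕ; zero; suc; _+_; _*_; _∸_; _≤_; _<_; NonZero)
open import Data.Nat.DivMod using (_mod_; _/_)
open import Data.Fin using (Fin; toℕ)
open import Data.Bool using (Bool; true; false; if_then_else_; _xor_)
open import Data.Product using (Σ; ∃; _×_; _,_)
open import Data.Sum using (_⊎_)
open import Data.List using (List; length)
open import Data.List.Membership.Propositional using (_∈_)
open import Data.List.Relation.Unary.Unique.Propositional using (Unique)
open import Relation.Binary.PropositionalEquality using (_≡_; _≢_)

-- Dihedral group D_{2n} of order 2n, concrete model:
-- the pair (i , e) stands for a^i b^e  (i ∈ Z/n, e ∈ {0,1}, true = 1).
-- Relations a^n = b^2 = 1, b a = a^{n-1} b give
--   (a^i b^e)(a^j b^f) = a^{i + (-1)^e j} b^{e+f}.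

module Dihedral (n : ℕ) .{{_ : NonZero n}} where

  D : Set
  D = Fin n × Bool

  _·_ : D → D → D
  (i , e) · (j , f) =
    ((toℕ i + (if e then n ∸ toℕ j else toℕ j)) mod n , e xor f)

  infixl 7 _·_

  one : D
  one = (0 mod n , false)

  _⁻¹ : D → D
  (i , false) ⁻¹ = ((n ∸ toℕ i) mod n , false)
  (i , true)  ⁻¹ = (i , true)

  a : D
  a = (1 mod n , false)

  b : D
  b = (0 mod n , true)

  a^ : ℕ → D
  a^ zero    = one
  a^ (suc k) = a · a^ k

  Ψ : D → Set
  Ψ x = (Σ ℕ λ i → (1 ≤ i × i < n) × x ≡ a^ i · b) ⊎ (x ≡ b ⊎ x ≡ a^ (n / 2))

CayAdj : {G : Set} → (G → G → G) → (G → G) → (G → Set) → G → G → Set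
CayAdj mul inv Q x y = Q (mul (inv x) y)

module Graph {V : Set} (E : V → V → Set) where

  data Walk : V → V → Set where
    nil  : ∀ {u} → Walk u u
    cons : ∀ {u w v} → E u w → Walk w v → Walk u v

  len : ∀ {u v} → Walk u v → ℕ
  len nil        = 0
  len (cons _ p) = suc (len p)

  OnWalk : ∀ {u v} → V → Walk u v → Set
  OnWalk {u} x nil        = x ≡ u
  OnWalk {u} x (cons _ p) = x ≡ u ⊎ OnWalk x p

  Shortest : ∀ {u v} → Walk u v → Set
  Shortest {u} {v} p = (q : Walk u v) → len p ≤ len q

  OnShortest : V → V → V → Set
  OnShortest x u v = Σ (Walk u v) λ p → Shortest p × OnWalk x p

  StronglyResolves : V → V → V → Set
  StronglyResolves w u v = OnShortest u v w ⊎ OnShortest v u w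

  StrongResolving : List V → Set
  StrongResolving S =
    (u v : V) → u ≢ v → Σ V λ w → w ∈ S × StronglyResolves w u v

  -- sdim = k : minimum cardinality of a strong resolving set is k
  -- (sets are duplicate-free lists, cardinality = length)
  SdimIs : ℕ → Set
  SdimIs k =
    (Σ (List V) λ S → Unique S × StrongResolving S × length S ≡ k)
    × ((S : List V) → Unique S → StrongResolving S → k ≤ length S)

module Submission where

-- Writing a^i b^e as (i , e), the side e separates rotations
-- from reflections.  Since every reflection lies in Ψ, vertices on different
-- sides are adjacent; x⁻¹y is a rotation for x, y on the same side, so they are
-- adjacent iff their indices differ by k (they are "antipodal").  Hence Λ has
-- diameter two and antipodal vertices are twins.
--
-- Call u farthest from v if no neighbour of u is farther from v.
-- For two mutually farthest vertices only they themselves strongly resolve the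
-- pair, so a strong resolving set contains one of them.  In Λ any two distinct
-- vertices on the same side are mutually farthest, so a strong resolving set
-- misses at most one vertex per side: |S| ≥ 2n − 2.  Conversely all vertices
-- but 1 and b form a strong resolving set: each vertex resolves itself from any
-- other, and the pair {1, b} is resolved by ab because b – 1 – ab is a geodesic.

open import Defs
import Data.Nat as ℕ
open import Data.Nat using (ℕ; zero; suc; _+_; _*_; _∸_; _≤_; _<_; NonZero; ≢-nonZero⁻¹; >-nonZero⁻¹; z≤n; s≤s; _%_; _/_)
open import Data.Nat.Properties
  using (suc-injective; ≤-refl; ≤-trans; <⇒≤; <⇒≱; +-assoc; +-comm; +-suc; +-identityʳ; *-comm; +-mono-≤; +-monoˡ-≤; +-monoʳ-<;
         m+[n∸m]≡n; m∸n+n≡m; m<m+n; n≢0⇒n>0; m≤n+o⇒m∸n≤o; module ≤-Reasoning)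
open import Data.Nat.DivMod using (_mod_; %-distribˡ-+; m%n%n≡m%n; [m+n]%n≡m%n; m<n⇒m%n≡m; m*n/n≡m)
open import Data.Fin as Fin using (Fin; toℕ)
import Data.Fin.Properties as Fin
open import Data.Fin.Properties using (toℕ-injective; toℕ-fromℕ<; toℕ<n; injective⇒≤)
open import Data.Bool using (Bool; true; false; not)
import Data.Bool.Properties as Bool
open import Data.Product using (Σ; ∃; _×_; _,_; proj₁; proj₂)
open import Data.Product.Properties using (≡-dec)
open import Data.Sum using (_⊎_; inj₁; inj₂; [_,_]′)
open import Data.Empty using (⊥-elim)
open import Function using (_∘_)
open import Function.Definitions using (Injective)
open import Relation.Nullary using (¬_; Dec; yes; no)
open import Relation.Unary using (Pred; Decidable)
open import Relation.Unary.Properties using (∁?)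
open import Relation.Binary.Definitions using (DecidableEquality)
open import Relation.Binary.PropositionalEquality
open import Data.List using (List; []; _∷_; length; map; filter; lookup; _++_; allFin)
open import Data.List.Properties using (length-++; length-map; length-tabulate)
open import Data.List.Membership.Propositional using (_∈_; _∉_)
open import Data.List.Membership.Propositional.Properties
  using (∈-lookup; ∈-filter⁻; ∈-++⁺ˡ; ∈-++⁺ʳ; ∈-map⁺; ∈-map⁻; ∈-allFin)
open import Data.List.Relation.Unary.All as All using (All; []; _∷_)
open import Data.List.Relation.Unary.All.Properties using (all-filter)
open import Data.List.Relation.Unary.Any as Any using (here; there)
open import Data.List.Relation.Unary.Any.Properties using (lookup-index)
open import Data.List.Relation.Unary.AllPairs using (AllPairs; []; _∷_)
import Data.List.Relation.Unary.AllPairs.Properties as AllPairs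
open import Data.List.Relation.Unary.Unique.Propositional using (Unique)
import Data.List.Relation.Unary.Unique.Propositional.Properties as Unique
open import Data.List.Relation.Binary.Disjoint.Propositional using (Disjoint)

lookup-injective : ∀ {A : Set} {xs : List A} → Unique xs → Injective _≡_ _≡_ (lookup xs)
lookup-injective {xs = _ ∷ _} (_    ∷ _) {Fin.zero}  {Fin.zero}  _  = refl
lookup-injective {xs = _ ∷ _} (x∉xs ∷ _) {Fin.zero}  {Fin.suc j} eq = ⊥-elim (All.lookup x∉xs (∈-lookup j) eq)
lookup-injective {xs = _ ∷ _} (x∉xs ∷ _) {Fin.suc i} {Fin.zero}  eq = ⊥-elim (All.lookup x∉xs (∈-lookup i) (sym eq))
lookup-injective {xs = _ ∷ _} (_    ∷ u) {Fin.suc i} {Fin.suc j} eq = cong Fin.suc (lookup-injective u eq)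

-- A duplicate-free list contained in ys is no longer than ys:
-- sending each position of xs to a position of its entry in ys is injective.
unique-⊆-length : ∀ {A : Set} {xs ys : List A} → Unique xs → (∀ {x} → x ∈ xs → x ∈ ys) →
                  length xs ≤ length ys
unique-⊆-length {xs = xs} {ys} u xs⊆ys = injective⇒≤ position-injective
  where
    position : Fin (length xs) → Fin (length ys)
    position i = Any.index (xs⊆ys (∈-lookup i))

    position-injective : Injective _≡_ _≡_ position
    position-injective {i} {j} eq = lookup-injective u (begin
      lookup xs i             ≡⟨ lookup-index (xs⊆ys (∈-lookup i)) ⟩
      lookup ys (position i)  ≡⟨ cong (lookup ys) eq ⟩
      lookup ys (position j)  ≡⟨ sym (lookup-index (xs⊆ys (∈-lookup j))) ⟩
      lookup xs j             ∎)
      where open ≡-Reasoning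

length-filter-∁ : ∀ {A : Set} {ℓ} {P : Pred A ℓ} (P? : Decidable P) (xs : List A) →
                  length (filter P? xs) + length (filter (∁? P?) xs) ≡ length xs
length-filter-∁ P? [] = refl
length-filter-∁ P? (x ∷ xs) with P? x
... | yes _ = cong suc (length-filter-∁ P? xs)
... | no  _ = trans (+-suc _ _) (cong suc (length-filter-∁ P? xs))

at-most-two-colours : {A : Set} (colour : A → Bool) {ys : List A} →
                      AllPairs (λ x y → colour x ≢ colour y) ys → length ys ≤ 2
at-most-two-colours colour {ys} distinct = begin
  length ys               ≡⟨ length-map colour ys ⟨
  length (map colour ys)  ≤⟨ unique-⊆-length (AllPairs.map⁺ {f = colour} distinct) every-bool ⟩
  2                       ∎
  where
    open ≤-Reasoning
    every-bool : ∀ {b} → b ∈ map colour ys → b ∈ false ∷ true ∷ []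
    every-bool {false} _ = here refl
    every-bool {true}  _ = there (here refl)

two-colour-cover : {A : Set} → DecidableEquality A → (colour : A → Bool) (S xs : List A) → Unique xs →
                   (∀ {x y} → x ≢ y → colour x ≡ colour y → x ∈ S ⊎ y ∈ S) →
                   length xs ≤ length S + 2
two-colour-cover {A} _≟_ colour S xs u cover = begin
  length xs                        ≡⟨ length-filter-∁ (_∈? S) xs ⟨
  length inside + length outside   ≤⟨ +-mono-≤ inside-bound outside-bound ⟩
  length S + 2                     ∎
  where
    open ≤-Reasoning
    open import Data.List.Membership.DecPropositional _≟_ using (_∈?_)
    inside outside : List A
    inside  = filter (_∈? S) xs
    outside = filter (∁? (_∈? S)) xs

    inside-bound : length inside ≤ length S
    inside-bound = unique-⊆-length (Unique.filter⁺ (_∈? S) u) (proj₂ ∘ ∈-filter⁻ (_∈? S) {xs = xs})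

    distinct-colours : ∀ {ys} → Unique ys → All (_∉ S) ys →
                       AllPairs (λ x y → colour x ≢ colour y) ys
    distinct-colours []                []              = []
    distinct-colours (x≢ys ∷ u′) (x∉S ∷ ys∉S) =
      All.zipWith (λ (x≢y , y∉S) same → [ x∉S , y∉S ]′ (cover x≢y same)) (x≢ys , ys∉S)
      ∷ distinct-colours u′ ys∉S

    outside-bound : length outside ≤ 2
    outside-bound = at-most-two-colours colour
      (distinct-colours (Unique.filter⁺ (∁? (_∈? S)) u) (all-filter (∁? (_∈? S)) xs))

module Geodesics {V : Set} (E : V → V → Set) where
  open Graph E

  _++ʷ_ : ∀ {x y z} → Walk x y → Walk y z → Walk x z
  nil      ++ʷ q = q
  cons e p ++ʷ q = cons e (p ++ʷ q)

  len-++ʷ : ∀ {x y z} (p : Walk x y) (q : Walk y z) → len (p ++ʷ q) ≡ len p + len q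
  len-++ʷ nil        q = refl
  len-++ʷ (cons e p) q = cong suc (len-++ʷ p q)

  split-at : ∀ {s t x} (p : Walk s t) → OnWalk x p →
             Σ (Walk s x) λ pre → Σ (Walk x t) λ suf → len pre + len suf ≡ len p
  split-at nil        refl       = nil , nil , refl
  split-at (cons e p) (inj₁ refl) = nil , cons e p , refl
  split-at (cons e p) (inj₂ on-p) with split-at p on-p
  ... | pre , suf , lens = cons e pre , suf , cong suc lens

  end-on-walk : ∀ {x y} (p : Walk x y) → OnWalk y p
  end-on-walk nil        = refl
  end-on-walk (cons _ p) = inj₂ (end-on-walk p)

  -- u is farthest from v: no neighbour of u is farther from v than u is,
  -- i.e. every walk from v to u can be redirected to any neighbour of u
  -- without getting longer.
  Farthest : V → V → Set
  Farthest v u = ∀ {y} (p : Walk v u) → E u y → Σ (Walk v y) λ q → len q ≤ len p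

  -- A shortest v–w path through a vertex u farthest from v must end at u:
  -- otherwise redirect its prefix to u's successor, producing a shorter walk.
  farthest-ends-geodesic : ∀ {u v w} → Farthest v u → OnShortest u v w → w ≡ u
  farthest-ends-geodesic far (p , shortest , on-p) with split-at p on-p
  ... | pre , nil        , _    = refl
  ... | pre , cons e suf , lens with far pre e
  ...   | q , q≤pre = ⊥-elim (<⇒≱ shorter (shortest (q ++ʷ suf)))
    where
      open ≤-Reasoning
      shorter : len (q ++ʷ suf) < len p
      shorter = begin-strict
        len (q ++ʷ suf)           ≡⟨ len-++ʷ q suf ⟩
        len q + len suf           ≤⟨ +-monoˡ-≤ (len suf) q≤pre ⟩
        len pre + len suf         <⟨ +-monoʳ-< (len pre) ≤-refl ⟩
        len pre + suc (len suf)   ≡⟨ lens ⟩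
        len p                     ∎

  -- Two mutually farthest vertices are strongly resolved only by themselves,
  -- so every strong resolving set contains one of them.
  resolving-meets-farthest-pair : ∀ {S u v} → StrongResolving S → u ≢ v →
                                  Farthest v u → Farthest u v → u ∈ S ⊎ v ∈ S
  resolving-meets-farthest-pair sr u≢v far-u far-v with sr _ _ u≢v
  ... | w , w∈S , inj₁ u-between = inj₁ (subst (_∈ _) (farthest-ends-geodesic far-u u-between) w∈S)
  ... | w , w∈S , inj₂ v-between = inj₂ (subst (_∈ _) (farthest-ends-geodesic far-v v-between) w∈S)

  middle-on-geodesic : ∀ {x y z} → x ≢ z → ¬ E x z → E x y → E y z → OnShortest y x z
  middle-on-geodesic {x} {y} {z} x≢z ¬xz xy yz = cons xy (cons yz nil) , at-least-two , inj₂ (inj₁ refl)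
    where
      at-least-two : Shortest (cons xy (cons yz nil))
      at-least-two nil                 = ⊥-elim (x≢z refl)
      at-least-two (cons xz nil)       = ⊥-elim (¬xz xz)
      at-least-two (cons _ (cons _ _)) = s≤s (s≤s z≤n)

module DiameterTwo {V : Set} (E : V → V → Set)
                   (short : ∀ x y → Σ (Graph.Walk E x y) λ p → Graph.len E p ≤ 2) where
  open Graph E
  open Geodesics E

  farthest : ∀ {u v} → u ≢ v → (E v u → ∀ {y} → E u y → y ≡ v ⊎ E v y) → Farthest v u
  farthest u≢v twins nil = ⊥-elim (u≢v refl)
  farthest u≢v twins (cons vu nil) uy with twins vu uy
  ... | inj₁ refl = nil , z≤n
  ... | inj₂ vy   = cons vy nil , ≤-refl
  farthest {v = v} u≢v twins {y} (cons _ (cons _ _)) _ =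
    proj₁ (short v y) , ≤-trans (proj₂ (short v y)) (s≤s (s≤s z≤n))

  module _ (_≟_ : DecidableEquality V) (adjacent? : ∀ x y → Dec (E x y)) where

    geodesic : ∀ x y → Σ (Walk x y) Shortest
    geodesic x y with x ≟ y
    ... | yes refl = nil , λ _ → z≤n
    ... | no x≢y with adjacent? x y
    ...   | yes xy = cons xy nil , single
      where
        single : Shortest (cons xy nil)
        single nil        = ⊥-elim (x≢y refl)
        single (cons _ _) = s≤s z≤n
    ...   | no ¬xy = proj₁ (short x y) , double
      where
        double : Shortest (proj₁ (short x y))
        double nil                 = ⊥-elim (x≢y refl)
        double (cons xy nil)       = ⊥-elim (¬xy xy)
        double (cons _ (cons _ q)) = ≤-trans (proj₂ (short x y)) (s≤s (s≤s z≤n))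

    endpoint-on-geodesic : ∀ u v → OnShortest v u v
    endpoint-on-geodesic u v = proj₁ (geodesic u v) , proj₂ (geodesic u v) , end-on-walk (proj₁ (geodesic u v))

module Modular (n : ℕ) .{{_ : NonZero n}} where
  toℕ-mod : ∀ x → toℕ (x mod n) ≡ x % n
  toℕ-mod x = toℕ-fromℕ< _

  %-absorbʳ : ∀ x y → (x + y % n) % n ≡ (x + y) % n
  %-absorbʳ x y = begin
    (x + y % n) % n          ≡⟨ %-distribˡ-+ x (y % n) n ⟩
    (x % n + y % n % n) % n  ≡⟨ cong (λ t → (x % n + t) % n) (m%n%n≡m%n y n) ⟩
    (x % n + y % n) % n      ≡⟨ %-distribˡ-+ x y n ⟨
    (x + y) % n              ∎
    where open ≡-Reasoning

  %-absorbˡ : ∀ x y → (x % n + y) % n ≡ (x + y) % n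
  %-absorbˡ x y = begin
    (x % n + y) % n  ≡⟨ cong (_% n) (+-comm (x % n) y) ⟩
    (y + x % n) % n  ≡⟨ %-absorbʳ y x ⟩
    (y + x) % n      ≡⟨ cong (_% n) (+-comm y x) ⟩
    (x + y) % n      ∎
    where open ≡-Reasoning

  %-self : ∀ {a} → a < n → a % n ≡ a
  %-self = m<n⇒m%n≡m

  toℕ-mod-self : ∀ {i} → i < n → toℕ (i mod n) ≡ i
  toℕ-mod-self i<n = trans (toℕ-mod _) (%-self i<n)

module Antipodes (n k : ℕ) .{{_ : NonZero n}} (n≡k+k : n ≡ k + k) where
  open Modular n

  -- k is a proper residue (n ≠ 0 forces k ≠ 0).
  k<n : k < n
  k<n = subst (k <_) (sym n≡k+k) (m<m+n k 0<k)
    where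
      0<k : 0 < k
      0<k = n≢0⇒n>0 (λ k≡0 → ≢-nonZero⁻¹ n (trans n≡k+k (cong (λ t → t + t) k≡0)))

  antipode : ℕ → ℕ
  antipode a = (a + k) % n

  antipode-involutive : ∀ {a} → a < n → antipode (antipode a) ≡ a
  antipode-involutive {a} a<n = begin
    ((a + k) % n + k) % n  ≡⟨ %-absorbˡ (a + k) k ⟩
    (a + k + k) % n        ≡⟨ cong (_% n) (+-assoc a k k) ⟩
    (a + (k + k)) % n      ≡⟨ cong (λ t → (a + t) % n) n≡k+k ⟨
    (a + n) % n            ≡⟨ [m+n]%n≡m%n a n ⟩
    a % n                  ≡⟨ %-self a<n ⟩
    a                      ∎
    where open ≡-Reasoning

  antipode-sym : ∀ {a b} → a < n → b ≡ antipode a → a ≡ antipode b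
  antipode-sym a<n refl = sym (antipode-involutive a<n)

  difference≡k⇒antipode : ∀ {a b} → a < n → b < n → (n ∸ a + b) % n ≡ k → b ≡ antipode a
  difference≡k⇒antipode {a} {b} a<n b<n diff = sym (begin
    (a + k) % n                ≡⟨ cong (λ t → (a + t) % n) diff ⟨
    (a + (n ∸ a + b) % n) % n  ≡⟨ %-absorbʳ a (n ∸ a + b) ⟩
    (a + (n ∸ a + b)) % n      ≡⟨ cong (_% n) (+-assoc a (n ∸ a) b) ⟨
    (a + (n ∸ a) + b) % n      ≡⟨ cong (λ t → (t + b) % n) (m+[n∸m]≡n (<⇒≤ a<n)) ⟩
    (n + b) % n                ≡⟨ cong (_% n) (+-comm n b) ⟩
    (b + n) % n                ≡⟨ [m+n]%n≡m%n b n ⟩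
    b % n                      ≡⟨ %-self b<n ⟩
    b                          ∎)
    where open ≡-Reasoning

  antipode⇒difference≡k : ∀ {a b} → a < n → b ≡ antipode a → (n ∸ a + b) % n ≡ k
  antipode⇒difference≡k {a} a<n refl = begin
    (n ∸ a + (a + k) % n) % n  ≡⟨ %-absorbʳ (n ∸ a) (a + k) ⟩
    (n ∸ a + (a + k)) % n      ≡⟨ cong (_% n) (+-assoc (n ∸ a) a k) ⟨
    (n ∸ a + a + k) % n        ≡⟨ cong (λ t → (t + k) % n) (m∸n+n≡m (<⇒≤ a<n)) ⟩
    (n + k) % n                ≡⟨ cong (_% n) (+-comm n k) ⟩
    (k + n) % n                ≡⟨ [m+n]%n≡m%n k n ⟩
    k % n                      ≡⟨ %-self k<n ⟩
    k                          ∎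
    where open ≡-Reasoning

module DihedralCoordinates (n : ℕ) .{{_ : NonZero n}} where
  open Dihedral n
  open Modular n

  -- a^i b^e lies on side e (rotations: false, reflections: true) and has index i.
  side : D → Bool
  side = proj₂

  index : D → ℕ
  index x = toℕ (proj₁ x)

  vertex-≡ : ∀ {x y : D} → index x ≡ index y → side x ≡ side y → x ≡ y
  vertex-≡ {_ , _} {_ , _} same-index refl = cong (_, _) (toℕ-injective same-index)

  _≟_ : DecidableEquality D
  _≟_ = ≡-dec Fin._≟_ Bool._≟_

  a^-index : ∀ j → a^ j ≡ (j mod n , false)
  a^-index zero    = refl
  a^-index (suc j) = vertex-≡ (begin
    toℕ ((toℕ (1 mod n) + toℕ (a^ j .proj₁)) mod n)  ≡⟨ toℕ-mod _ ⟩
    (toℕ (1 mod n) + toℕ (a^ j .proj₁)) % n         ≡⟨ cong₂ (λ s t → (s + t) % n) (toℕ-mod 1) (cong index (a^-index j)) ⟩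
    (1 % n + toℕ (j mod n)) % n                     ≡⟨ cong (λ t → (1 % n + t) % n) (toℕ-mod j) ⟩
    (1 % n + j % n) % n                             ≡⟨ %-distribˡ-+ 1 j n ⟨
    suc j % n                                       ≡⟨ toℕ-mod (suc j) ⟨
    toℕ (suc j mod n)                               ∎) (cong side (a^-index j))
    where open ≡-Reasoning

  a^i·b : ∀ i → a^ i · b ≡ (i mod n , true)
  a^i·b i = begin
    a^ i · b                 ≡⟨ cong (_· b) (a^-index i) ⟩
    (i mod n , false) · b    ≡⟨ vertex-≡ same-index refl ⟩
    (i mod n , true)         ∎
    where
      open ≡-Reasoning
      x : ℕ
      x = toℕ (i mod n)
      same-index : toℕ ((x + toℕ (0 mod n)) mod n) ≡ x
      same-index = begin
        toℕ ((x + toℕ (0 mod n)) mod n)  ≡⟨ toℕ-mod _ ⟩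
        (x + toℕ (0 mod n)) % n          ≡⟨ cong (λ t → (x + t) % n) (toℕ-mod 0) ⟩
        (x + 0 % n) % n                  ≡⟨ %-absorbʳ x 0 ⟩
        (x + 0) % n                      ≡⟨ cong (_% n) (+-identityʳ x) ⟩
        x % n                            ≡⟨ %-self (toℕ<n (i mod n)) ⟩
        x                                ∎

  rotation-quotient : ∀ i j → index ((i , false) ⁻¹ · (j , false)) ≡ (n ∸ toℕ i + toℕ j) % n
  rotation-quotient i j = begin
    toℕ ((toℕ ((n ∸ toℕ i) mod n) + toℕ j) mod n)  ≡⟨ toℕ-mod _ ⟩
    (toℕ ((n ∸ toℕ i) mod n) + toℕ j) % n          ≡⟨ cong (λ t → (t + toℕ j) % n) (toℕ-mod (n ∸ toℕ i)) ⟩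
    ((n ∸ toℕ i) % n + toℕ j) % n                  ≡⟨ %-absorbˡ (n ∸ toℕ i) (toℕ j) ⟩
    (n ∸ toℕ i + toℕ j) % n                        ∎
    where open ≡-Reasoning

  reflection-quotient : ∀ i j → index ((i , true) ⁻¹ · (j , true)) ≡ (n ∸ toℕ j + toℕ i) % n
  reflection-quotient i j = trans (toℕ-mod _) (cong (_% n) (+-comm (toℕ i) (n ∸ toℕ j)))

module CayleyGraph (n k : ℕ) .{{_ : NonZero n}} (n≡k+k : n ≡ k + k) where
  open Dihedral n
  open Modular n
  open Antipodes n k n≡k+k
  open DihedralCoordinates n

  Λ : D → D → Set
  Λ = CayAdj _·_ _⁻¹ Ψ

  a^half : a^ (n / 2) ≡ (k mod n , false)
  a^half = trans (cong a^ half) (a^-index k)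
    where
      half : n / 2 ≡ k
      half = begin
        n / 2          ≡⟨ cong (_/ 2) n≡k+k ⟩
        (k + k) / 2    ≡⟨ cong (λ t → (k + t) / 2) (+-identityʳ k) ⟨
        (2 * k) / 2    ≡⟨ cong (_/ 2) (*-comm 2 k) ⟩
        (k * 2) / 2    ≡⟨ m*n/n≡m k 2 ⟩
        k              ∎
        where open ≡-Reasoning

  Ψ-reflection : ∀ c → Ψ (c , true)
  Ψ-reflection c with toℕ c in c≡
  ... | zero  = inj₂ (inj₁ (vertex-≡ (trans c≡ (sym (toℕ-mod-self (>-nonZero⁻¹ n)))) refl))
  ... | suc t = inj₁ (suc t , (s≤s z≤n , subst (_< n) c≡ (toℕ<n c)) , sym (begin
    a^ (suc t) · b       ≡⟨ a^i·b (suc t) ⟩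
    (suc t mod n , true) ≡⟨ vertex-≡ (trans (toℕ-mod-self (subst (_< n) c≡ (toℕ<n c))) (sym c≡)) refl ⟩
    (c , true)           ∎))
    where open ≡-Reasoning

  Ψ-rotation⇒ : ∀ c → Ψ (c , false) → toℕ c ≡ k
  Ψ-rotation⇒ c (inj₁ (i , _ , c≡a^ib)) with () ← trans (cong side c≡a^ib) (cong side (a^i·b i))
  Ψ-rotation⇒ c (inj₂ (inj₂ c≡a^half)) = trans (cong index (trans c≡a^half a^half)) (toℕ-mod-self k<n)

  Ψ-rotation⇐ : ∀ c → toℕ c ≡ k → Ψ (c , false)
  Ψ-rotation⇐ c c≡k =
    inj₂ (inj₂ (trans (vertex-≡ (trans c≡k (sym (toℕ-mod-self k<n))) refl) (sym a^half)))

  Antipodal : D → D → Set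
  Antipodal x y = side x ≡ side y × index y ≡ antipode (index x)

  antipodal-sym : ∀ {x y} → Antipodal x y → Antipodal y x
  antipodal-sym {x} (same-side , y≡) = sym same-side , antipode-sym (toℕ<n (proj₁ x)) y≡

  adjacent-across : ∀ {x y} → side x ≢ side y → Λ x y
  adjacent-across {_ , false} {_ , false} different = ⊥-elim (different refl)
  adjacent-across {_ , false} {_ , true}  _         = Ψ-reflection _
  adjacent-across {_ , true}  {_ , false} _         = Ψ-reflection _
  adjacent-across {_ , true}  {_ , true}  different = ⊥-elim (different refl)

  adjacent-antipodal : ∀ {x y} → Antipodal x y → Λ x y
  adjacent-antipodal {i , false} {j , false} (_ , j≡) =
    Ψ-rotation⇐ _ (trans (rotation-quotient i j) (antipode⇒difference≡k (toℕ<n i) j≡))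
  adjacent-antipodal {i , true}  {j , true}  xy =
    Ψ-rotation⇐ _ (trans (reflection-quotient i j) (antipode⇒difference≡k (toℕ<n j) (proj₂ (antipodal-sym xy))))

  adjacent-cases : ∀ {x y} → Λ x y → side x ≢ side y ⊎ Antipodal x y
  adjacent-cases {i , false} {j , false} xy = inj₂ (refl ,
    difference≡k⇒antipode (toℕ<n i) (toℕ<n j) (trans (sym (rotation-quotient i j)) (Ψ-rotation⇒ _ xy)))
  adjacent-cases {i , true}  {j , true}  xy = inj₂ (antipodal-sym (refl ,
    difference≡k⇒antipode (toℕ<n j) (toℕ<n i) (trans (sym (reflection-quotient i j)) (Ψ-rotation⇒ _ xy))))
  adjacent-cases {_ , false} {_ , true}  _  = inj₁ (λ ())
  adjacent-cases {_ , true}  {_ , false} _  = inj₁ (λ ())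

  adjacent? : ∀ x y → Dec (Λ x y)
  adjacent? x y with side x Bool.≟ side y
  ... | no different = yes (adjacent-across different)
  ... | yes same-side with index y ℕ.≟ antipode (index x)
  ...   | yes y≡ = yes (adjacent-antipodal (same-side , y≡))
  ...   | no  y≢ = no (λ xy → [ (λ different → different same-side) , (λ anti → y≢ (proj₂ anti)) ]′ (adjacent-cases xy))

  antipodal-twins : ∀ {u v y} → Antipodal v u → Λ u y → y ≡ v ⊎ Λ v y
  antipodal-twins {u} {v} {y} (vu-side , u≡) uy with adjacent-cases uy
  ... | inj₁ different    = inj₂ (adjacent-across (λ vy-side → different (trans (sym vu-side) vy-side)))
  ... | inj₂ (uy-side , y≡) = inj₁ (vertex-≡ y≡v (sym (trans vu-side uy-side)))
    where
      y≡v : index y ≡ index v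
      y≡v = trans y≡ (trans (cong antipode u≡) (antipode-involutive (toℕ<n (proj₁ v))))

  open Graph Λ

  -- Λ has diameter at most two: two vertices on the same side share every
  -- neighbour on the other side.
  walk≤2 : ∀ x y → Σ (Walk x y) λ p → len p ≤ 2
  walk≤2 x y with side x Bool.≟ side y
  ... | no different  = cons (adjacent-across different) nil , s≤s z≤n
  ... | yes same-side =
    cons (adjacent-across {x} {opposite} (Bool.not-¬ refl))
      (cons (adjacent-across {opposite} {y} (λ eq → Bool.not-¬ (sym same-side) (sym eq))) nil) , ≤-refl
    where
      opposite : D
      opposite = proj₁ x , not (side x)

  open Geodesics Λ
  open DiameterTwo Λ walk≤2

  same-side-farthest : ∀ {u v} → u ≢ v → side u ≡ side v → Farthest v u
  same-side-farthest {u} {v} u≢v same-side = farthest u≢v λ vu → case-antipodal (adjacent-cases vu)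
    where
      case-antipodal : side v ≢ side u ⊎ Antipodal v u → ∀ {y} → Λ u y → y ≡ v ⊎ Λ v y
      case-antipodal (inj₁ different) = ⊥-elim (different (sym same-side))
      case-antipodal (inj₂ anti)      = antipodal-twins anti

vertices : ∀ {p} → List (Fin p) → List (Fin p × Bool)
vertices is = map (_, false) is ++ map (_, true) is

vertices-unique : ∀ {p} {is : List (Fin p)} → Unique is → Unique (vertices is)
vertices-unique {is = is} u = Unique.++⁺ (Unique.map⁺ (cong proj₁) u) (Unique.map⁺ (cong proj₁) u) sides-differ
  where
    sides-differ : Disjoint (map (_, false) is) (map (_, true) is)
    sides-differ (x∈rotations , x∈reflections) with ∈-map⁻ (_, false) x∈rotations | ∈-map⁻ (_, true) x∈reflections
    ... | _ , _ , refl | _ , _ , ()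

vertices-length : ∀ {p} (is : List (Fin p)) → length (vertices is) ≡ length is + length is
vertices-length is = trans (length-++ (map (_, false) is)) (cong₂ _+_ (length-map (_, false) is) (length-map (_, true) is))

∈-vertices : ∀ {p} {is : List (Fin p)} {i} e → i ∈ is → (i , e) ∈ vertices is
∈-vertices {is = is} false i∈is = ∈-++⁺ˡ (∈-map⁺ (_, false) i∈is)
∈-vertices {is = is} true  i∈is = ∈-++⁺ʳ (map (_, false) is) (∈-map⁺ (_, true) i∈is)

module StrongDimension (m k : ℕ) (n≡k+k : suc (suc m) ≡ k + k) (k≢1 : k ≢ 1) where
  n : ℕ
  n = suc (suc m)

  open Dihedral n using (D)
  open Modular n using (%-self)
  open Antipodes n k n≡k+k using (k<n)
  open DihedralCoordinates n using (side; _≟_)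
  open CayleyGraph n k n≡k+k
  open Graph Λ
  open Geodesics Λ
  open DiameterTwo Λ walk≤2

  length-allFin : ∀ p → length (allFin p) ≡ p
  length-allFin p = length-tabulate (λ i → i)

  -- Lower bound: a strong resolving set contains one of any two distinct
  -- vertices on the same side, so it misses at most two of the 2n vertices.
  lower-bound : ∀ S → StrongResolving S → 2 * n ∸ 2 ≤ length S
  lower-bound S resolving = m≤n+o⇒m∸n≤o (2 * n) 2 (begin
    2 * n                                  ≡⟨ cong (n +_) (+-identityʳ n) ⟩
    n + n                                  ≡⟨ cong₂ _+_ (length-allFin n) (length-allFin n) ⟨
    length (allFin n) + length (allFin n)  ≡⟨ vertices-length (allFin n) ⟨
    length (vertices (allFin n))           ≤⟨ two-colour-cover _≟_ side S (vertices (allFin n)) (vertices-unique (Unique.allFin⁺ n)) meets ⟩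
    length S + 2                           ≡⟨ +-comm (length S) 2 ⟩
    2 + length S                           ∎)
    where
      open ≤-Reasoning
      meets : ∀ {u v} → u ≢ v → side u ≡ side v → u ∈ S ⊎ v ∈ S
      meets u≢v same-side = resolving-meets-farthest-pair resolving u≢v
        (same-side-farthest u≢v same-side) (same-side-farthest (≢-sym u≢v) (sym same-side))

  -- Upper bound: every vertex except the identity a^0 and the reflection b.
  S₀ : List D
  S₀ = vertices (map Fin.suc (allFin (suc m)))

  S₀-unique : Unique S₀
  S₀-unique = vertices-unique (Unique.map⁺ Fin.suc-injective (Unique.allFin⁺ (suc m)))

  S₀-length : length S₀ ≡ 2 * n ∸ 2
  S₀-length = begin
    length S₀                  ≡⟨ vertices-length (map Fin.suc (allFin (suc m))) ⟩
    length (map Fin.suc (allFin (suc m))) + length (map Fin.suc (allFin (suc m)))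
                               ≡⟨ cong (λ l → l + l) (trans (length-map Fin.suc (allFin (suc m))) (length-allFin (suc m))) ⟩
    suc m + suc m              ≡⟨ +-suc m (suc m) ⟨
    m + n                      ≡⟨ cong (m +_) (+-identityʳ n) ⟨
    2 * n ∸ 2                  ∎
    where open ≡-Reasoning

  ∈S₀ : ∀ i e → (Fin.suc i , e) ∈ S₀
  ∈S₀ i e = ∈-vertices e (∈-map⁺ Fin.suc (∈-allFin i))

  -- The identity and b are resolved by the reflection ab: b – 1 – ab is a
  -- geodesic, as b and ab are not antipodal (k ≠ 1).
  ab : D
  ab = Fin.suc Fin.zero , true

  identity-between : OnShortest (Fin.zero , false) (Fin.zero , true) ab
  identity-between = middle-on-geodesic (λ ()) b≁ab
    (adjacent-across {Fin.zero , true} {Fin.zero , false} (λ ()))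
    (adjacent-across {Fin.zero , false} {ab} (λ ()))
    where
      b≁ab : ¬ Λ (Fin.zero , true) ab
      b≁ab b~ab with adjacent-cases {Fin.zero , true} {ab} b~ab
      ... | inj₁ different  = different refl
      ... | inj₂ (_ , 1≡k%n) = k≢1 (sym (trans 1≡k%n (%-self k<n)))

  S₀-resolving : StrongResolving S₀
  S₀-resolving (Fin.suc i , e)    v                  _   = _ , ∈S₀ i e , inj₁ (endpoint-on-geodesic _≟_ adjacent? v _)
  S₀-resolving u@(Fin.zero , _)   (Fin.suc j , f)    _   = _ , ∈S₀ j f , inj₂ (endpoint-on-geodesic _≟_ adjacent? u _)
  S₀-resolving (Fin.zero , false) (Fin.zero , true)  _   = ab , ∈S₀ Fin.zero true , inj₁ identity-between
  S₀-resolving (Fin.zero , true)  (Fin.zero , false) _   = ab , ∈S₀ Fin.zero true , inj₂ identity-between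
  S₀-resolving (Fin.zero , false) (Fin.zero , false) u≢v = ⊥-elim (u≢v refl)
  S₀-resolving (Fin.zero , true)  (Fin.zero , true)  u≢v = ⊥-elim (u≢v refl)

  sdim : SdimIs (2 * n ∸ 2)
  sdim = (S₀ , S₀-unique , S₀-resolving , S₀-length) , λ S _ resolving → lower-bound S resolving

theorem3p8 : (n : ℕ) .{{_ : NonZero n}} → 4 ≤ n → ∃ (λ k → n ≡ 2 * k)
    → Graph.SdimIs (CayAdj (Dihedral._·_ n) (Dihedral._⁻¹ n) (Dihedral.Ψ n)) (2 * n ∸ 2)
theorem3p8 (suc (suc m)) (s≤s (s≤s 2≤m)) (k , n≡2k) = StrongDimension.sdim m k n≡k+k k≢1
  where
    n≡k+k : suc (suc m) ≡ k + k
    n≡k+k = trans n≡2k (cong (k +_) (+-identityʳ k))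

    m≡0 : k ≡ 1 → m ≡ 0
    m≡0 k≡1 = suc-injective (suc-injective (trans n≡k+k (cong (λ t → t + t) k≡1)))

    k≢1 : k ≢ 1
    k≢1 k≡1 with () ← subst (2 ≤_) (m≡0 k≡1) 2≤m
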